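{- Consider the affine plane curves over $\mathbb{Q}$ (in coordinates $(t,x)$) $C_{P+Q}: x^4 + 2t^2x^2 - 8t^2x + t^4 + t(4x^3 - 4t^2x + 4t^2) = 0$, $C_Q: x^4 + 2t^2x^2 - 8t^2x + t^4 = 0$, $C_2: x^3 - t^2x + t^2 = 0$. None of these curves has a point $(t_0, x_0) \in \mathbb{Z}^2$ with $t_0 > 2$. -}

module Defs where

open import Data.Integer using (ℤ; _+_; _-_; _*_; _^_; +_)

fPQ : ℤ → ℤ → ℤ
fPQ t x = x ^ 4 + + 2 * t ^ 2 * x ^ 2 - + 8 * t ^ 2 * x + t ^ 4
          + t * (+ 4 * x ^ 3 - + 4 * t ^ 2 * x + + 4 * t ^ 2)

fQ : ℤ → ℤ → ℤ
fQ t x = x ^ 4 + + 2 * t ^ 2 * x ^ 2 - + 8 * t ^ 2 * x + t ^ 4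

f2 : ℤ → ℤ → ℤ
f2 t x = x ^ 3 - t ^ 2 * x + t ^ 2

-- For t ≥ 3 the polynomials of C_Q and C_{P+Q} are visibly positive:
-- fQ = x⁴ + t²(2(x − 2)² + t² − 8), and the shear y = 2x − t turns 16 fPQ into
-- gPQ(t, y) = (t² + 6ty + y²)² − 64t²y, which is t⁴ at y = 0, a square plus 64t²|y|
-- for y < 0, and a polynomial with positive coefficients in y − 1 and t − 3 for y > 0.
-- For C_2, f2 = (x − 1)(x² + x + 1 − t²) + 1 forces x − 1 = ±1, and at x = 0, 2 the
-- polynomial equals t² and 8 − t², both nonzero once t² > 8.
module Submission where

open import Defs
open import Data.Integer
  using ( ℤ; _>_; +_; 0ℤ; +[1+_]; -[1+_]; 1ℤ; -1ℤ; _+_; _-_; _*_; -_; _^_; _<_; ∣_∣; +<+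
        ; Positive; NonNegative; positive)
open import Data.Integer.Properties
  using (pos-*; abs-*; ^-identityʳ; +-comm; +-monoˡ-<; +-inverseʳ; <-trans; i-j≡0⇒i≡j; +-minus-telescope; +-identityʳ)
open import Data.Integer.Solver using (module +-*-Solver)
open import Data.Nat as ℕ using (s≤s; z≤n)
open import Data.Nat.Properties using (m*n≡1⇒m≡1; m≤m+n; ^-monoˡ-≤)
open import Data.Product using (_×_; _,_)
open import Data.Sum using (_⊎_; inj₁; inj₂; [_,_]′)
open import Relation.Binary.PropositionalEquality
  using (_≡_; _≢_; refl; sym; trans; cong; subst; module ≡-Reasoning)

open +-*-Solver using (Polynomial; solve; _:=_; _:+_; _:-_; :-_; _:*_; _:^_; con)

private variable i j : ℤ

pos⇒≢0 : Positive i → i ≢ 0ℤ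
pos⇒≢0 {+[1+ _ ]} _ ()

nonNeg*nonNeg⇒nonNeg : NonNegative i → NonNegative j → NonNegative (i * j)
nonNeg*nonNeg⇒nonNeg {+ m} {+ n} _ _ = subst NonNegative (pos-* m n) _

pos+nonNeg⇒pos : Positive i → NonNegative j → Positive (i + j)
pos+nonNeg⇒pos {+[1+ _ ]} {+ _} _ _ = _

nonNeg+pos⇒pos : NonNegative i → Positive j → Positive (i + j)
nonNeg+pos⇒pos {i} {j} i≥0 j>0 = subst Positive (+-comm j i) (pos+nonNeg⇒pos j>0 i≥0)

pos+pos⇒pos : Positive i → Positive j → Positive (i + j)
pos+pos⇒pos {+[1+ _ ]} {+[1+ _ ]} _ _ = _

pos*pos⇒pos : Positive i → Positive j → Positive (i * j)
pos*pos⇒pos {+[1+ _ ]} {+[1+ _ ]} _ _ = _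

i^2-nonNeg : ∀ i → NonNegative (i ^ 2)
i^2-nonNeg (+ n)    = subst NonNegative (trans (pos-* n n) (cong (+ n *_) (sym (^-identityʳ (+ n))))) _
i^2-nonNeg -[1+ _ ] = _

i<j⇒pos[j-i] : i < j → Positive (j - i)
i<j⇒pos[j-i] {i} {j} i<j = positive (subst (_< j - i) (+-inverseʳ i) (+-monoˡ-< (- i) i<j))

∣i∣≡1⇒i≡1⊎i≡-1 : ∀ i → ∣ i ∣ ≡ 1 → i ≡ 1ℤ ⊎ i ≡ -1ℤ
∣i∣≡1⇒i≡1⊎i≡-1 (+ 0)                 ()
∣i∣≡1⇒i≡1⊎i≡-1 (+ 1)                 _ = inj₁ refl
∣i∣≡1⇒i≡1⊎i≡-1 (+ ℕ.suc (ℕ.suc _)) ()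
∣i∣≡1⇒i≡1⊎i≡-1 -[1+ 0 ]              _ = inj₂ refl
∣i∣≡1⇒i≡1⊎i≡-1 -[1+ ℕ.suc _ ]        ()

i*j≡-1⇒i≡1⊎i≡-1 : i * j ≡ -1ℤ → i ≡ 1ℤ ⊎ i ≡ -1ℤ
i*j≡-1⇒i≡1⊎i≡-1 {i} {j} ij≡-1 =
  ∣i∣≡1⇒i≡1⊎i≡-1 i (m*n≡1⇒m≡1 ∣ i ∣ ∣ j ∣ (trans (sym (abs-* i j)) (cong ∣_∣ ij≡-1)))

t>2⇒t²>8 : ∀ {t} → t > + 2 → t ^ 2 > + 8
t>2⇒t²>8 (+<+ (s≤s (s≤s (s≤s {n = a} _)))) = +<+ (^-monoˡ-≤ 2 (m≤m+n 3 a))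

fQ-decomposition : ∀ t x → fQ t x ≡ (x ^ 2) ^ 2 + t ^ 2 * (+ 2 * (x - + 2) ^ 2 + (t ^ 2 - + 8))
fQ-decomposition = solve 2 (λ t x →
  x :^ 4 :+ con (+ 2) :* t :^ 2 :* x :^ 2 :- con (+ 8) :* t :^ 2 :* x :+ t :^ 4
  := (x :^ 2) :^ 2 :+ t :^ 2 :* (con (+ 2) :* (x :- con (+ 2)) :^ 2 :+ (t :^ 2 :- con (+ 8)))) refl

fQ-positive : ∀ t x → t ^ 2 > + 8 → Positive (fQ t x)
fQ-positive t x t²>8 = subst Positive (sym (fQ-decomposition t x))
  (nonNeg+pos⇒pos (i^2-nonNeg (x ^ 2)) (pos*pos⇒pos t²>0 (nonNeg+pos⇒pos 2[x-2]²≥0 (i<j⇒pos[j-i] t²>8))))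
  where
  t²>0 : Positive (t ^ 2)
  t²>0 = positive (<-trans (+<+ (s≤s z≤n)) t²>8)
  2[x-2]²≥0 : NonNegative (+ 2 * (x - + 2) ^ 2)
  2[x-2]²≥0 = nonNeg*nonNeg⇒nonNeg {+ 2} _ (i^2-nonNeg (x - + 2))

f2-factorisation : ∀ t x → f2 t x ≡ (x - + 1) * (x ^ 2 + x + + 1 - t ^ 2) + + 1
f2-factorisation = solve 2 (λ t x →
  x :^ 3 :- t :^ 2 :* x :+ t :^ 2
  := (x :- con (+ 1)) :* (x :^ 2 :+ x :+ con (+ 1) :- t :^ 2) :+ con (+ 1)) refl

f2-at-0 : ∀ t → f2 t 0ℤ ≡ t ^ 2
f2-at-0 = solve 1 (λ t → con 0ℤ :^ 3 :- t :^ 2 :* con 0ℤ :+ t :^ 2 := t :^ 2) refl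

f2-at-2 : ∀ t → t ^ 2 - + 8 ≡ - f2 t (+ 2)
f2-at-2 = solve 1 (λ t → t :^ 2 :- con (+ 8) := :- (con (+ 2) :^ 3 :- t :^ 2 :* con (+ 2) :+ t :^ 2)) refl

f2≢0 : ∀ t x → t ^ 2 > + 8 → f2 t x ≢ 0ℤ
f2≢0 t x t²>8 f2≡0 = [ x-1≢1 , x-1≢-1 ]′ (i*j≡-1⇒i≡1⊎i≡-1 [x-1]*W≡-1)
  where
  open ≡-Reasoning
  [x-1]*W≡-1 : (x - + 1) * (x ^ 2 + x + + 1 - t ^ 2) ≡ -1ℤ
  [x-1]*W≡-1 = i-j≡0⇒i≡j _ -1ℤ (trans (sym (f2-factorisation t x)) f2≡0)
  x-1≡c⇒x≡c+1 : ∀ {c} → x - + 1 ≡ c → x ≡ c + + 1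
  x-1≡c⇒x≡c+1 {c} x-1≡c = begin
    x                   ≡⟨ trans (+-minus-telescope x (+ 1) 0ℤ) (+-identityʳ x) ⟨
    (x - + 1) + + 1     ≡⟨ cong (_+ + 1) x-1≡c ⟩
    c + + 1             ∎
  x-1≢1 : x - + 1 ≢ 1ℤ
  x-1≢1 x-1≡1 = pos⇒≢0 (i<j⇒pos[j-i] t²>8) (begin
    t ^ 2 - + 8   ≡⟨ f2-at-2 t ⟩
    - f2 t (+ 2)  ≡⟨ cong (λ y → - f2 t y) (x-1≡c⇒x≡c+1 x-1≡1) ⟨
    - f2 t x      ≡⟨ cong -_ f2≡0 ⟩
    0ℤ            ∎)
  x-1≢-1 : x - + 1 ≢ -1ℤ
  x-1≢-1 x-1≡-1 = pos⇒≢0 (positive (<-trans (+<+ (s≤s z≤n)) t²>8)) (begin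
    t ^ 2         ≡⟨ f2-at-0 t ⟨
    f2 t 0ℤ       ≡⟨ cong (f2 t) (x-1≡c⇒x≡c+1 x-1≡-1) ⟨
    f2 t x        ≡⟨ f2≡0 ⟩
    0ℤ            ∎)

gPQ : ℤ → ℤ → ℤ
gPQ t y = (t ^ 2 + + 6 * t * y + y ^ 2) ^ 2 - + 64 * t ^ 2 * y

fPQ-shear : ∀ t x → + 16 * fPQ t x ≡ gPQ t (+ 2 * x - t)
fPQ-shear = solve 2 (λ t x →
  con (+ 16) :* (x :^ 4 :+ con (+ 2) :* t :^ 2 :* x :^ 2 :- con (+ 8) :* t :^ 2 :* x :+ t :^ 4
                 :+ t :* (con (+ 4) :* x :^ 3 :- con (+ 4) :* t :^ 2 :* x :+ con (+ 4) :* t :^ 2))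
  := (t :^ 2 :+ con (+ 6) :* t :* y x t :+ y x t :^ 2) :^ 2 :- con (+ 64) :* t :^ 2 :* y x t) refl
  where
  y : Polynomial 2 → Polynomial 2 → Polynomial 2
  y x t = con (+ 2) :* x :- t

gPQ-at-0 : ∀ t → gPQ t 0ℤ ≡ (t ^ 2) ^ 2
gPQ-at-0 = solve 1 (λ t →
  (t :^ 2 :+ con (+ 6) :* t :* con 0ℤ :+ con 0ℤ :^ 2) :^ 2 :- con (+ 64) :* t :^ 2 :* con 0ℤ
  := (t :^ 2) :^ 2) refl

gPQ-at-neg : ∀ t s → gPQ t (- s) ≡ (t ^ 2 - + 6 * t * s + s ^ 2) ^ 2 + + 64 * t ^ 2 * s
gPQ-at-neg = solve 2 (λ t s →
  (t :^ 2 :+ con (+ 6) :* t :* (:- s) :+ (:- s) :^ 2) :^ 2 :- con (+ 64) :* t :^ 2 :* (:- s)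
  := (t :^ 2 :- con (+ 6) :* t :* s :+ s :^ 2) :^ 2 :+ con (+ 64) :* t :^ 2 :* s) refl

gPQ-at-pos : ∀ a k → gPQ (+ 3 + a) (+ 1 + k) ≡
  (+ 1 + k) ^ 4 + + 12 * (+ 1 + k) ^ 3 * (+ 3 + a) + (+ 3 + a) ^ 4
  + (+ 1 + k) * (+ 3 + a) ^ 2 * (+ 10 + + 38 * k + + 12 * a)
gPQ-at-pos = solve 2 (λ a k →
  (t a :^ 2 :+ con (+ 6) :* t a :* s k :+ s k :^ 2) :^ 2 :- con (+ 64) :* t a :^ 2 :* s k
  := s k :^ 4 :+ con (+ 12) :* s k :^ 3 :* t a :+ t a :^ 4
     :+ s k :* t a :^ 2 :* (con (+ 10) :+ con (+ 38) :* k :+ con (+ 12) :* a)) refl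
  where
  t s : Polynomial 2 → Polynomial 2
  t a = con (+ 3) :+ a
  s k = con (+ 1) :+ k

-- With t = 3 + a and s = 1 + k, products of t, s and positive constants normalise to
-- +[1+ _], so their positivity holds by computation; products with a or k do not.
gPQ-positive : ∀ a y → Positive (gPQ (+ 3 + + a) y)
gPQ-positive a (+ 0)    = subst Positive (sym (gPQ-at-0 (+ 3 + + a))) _
gPQ-positive a -[1+ k ] = subst Positive (sym (gPQ-at-neg t s))
  (nonNeg+pos⇒pos (i^2-nonNeg (t ^ 2 - + 6 * t * s + s ^ 2)) 64t²s>0)
  where
  t s : ℤ
  t = + 3 + + a
  s = +[1+ k ]
  64t²s>0 : Positive (+ 64 * t ^ 2 * s)
  64t²s>0 = _
gPQ-positive a +[1+ k ] = subst Positive (sym (gPQ-at-pos (+ a) (+ k)))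
  (pos+pos⇒pos s⁴+12s³t+t⁴>0 (pos*pos⇒pos st²>0 10+38k+12a>0))
  where
  t s : ℤ
  t = + 3 + + a
  s = +[1+ k ]
  s⁴+12s³t+t⁴>0 : Positive (s ^ 4 + + 12 * s ^ 3 * t + t ^ 4)
  s⁴+12s³t+t⁴>0 = _
  st²>0 : Positive (s * t ^ 2)
  st²>0 = _
  10+38k+12a>0 : Positive (+ 10 + + 38 * + k + + 12 * + a)
  10+38k+12a>0 rewrite sym (pos-* 38 k) | sym (pos-* 12 a) = _

fPQ≢0 : ∀ t x → t > + 2 → fPQ t x ≢ 0ℤ
fPQ≢0 t x (+<+ (s≤s (s≤s (s≤s {n = a} _)))) fPQ≡0 = pos⇒≢0 (gPQ-positive a (+ 2 * x - t)) (begin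
  gPQ t (+ 2 * x - t)  ≡⟨ fPQ-shear t x ⟨
  + 16 * fPQ t x       ≡⟨ cong (+ 16 *_) fPQ≡0 ⟩
  0ℤ                   ∎)
  where open ≡-Reasoning

proposition4p4 : (t x : ℤ) → t > + 2 →
                   (fPQ t x ≢ 0ℤ) × (fQ t x ≢ 0ℤ) × (f2 t x ≢ 0ℤ)
proposition4p4 t x t>2 = fPQ≢0 t x t>2 , pos⇒≢0 (fQ-positive t x t²>8) , f2≢0 t x t²>8
  where
  t²>8 : t ^ 2 > + 8
  t²>8 = t>2⇒t²>8 t>2
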